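{- For every $m\ge 1$, the graph $G_m$ is ternary.
   Context: A graph is ternary if it has no induced cycle whose length is divisible by three. The graphs $G_m$ are defined recursively: $G_1$ has vertices $a_1,b_1$ and the single edge $a_1b_1$. For $m\ge 1$, $G_{m+1}$ is obtained from $G_m$ by adding new vertices $a_{m+1},b_{m+1},c_{m+1}$ and the edges $a_ma_{m+1}$, $b_mc_{m+1}$, $a_{m+1}b_{m+1}$, $b_{m+1}c_{m+1}$, and, when $m\ge 2$, also $c_ma_{m+1}$. (Thus $G_2$ is the $5$-cycle $a_1b_1c_2b_2a_2a_1$.) -}

module Defs where

open import Data.Nat using (ℕ; zero; suc; _≤_; _∸_)
open import Data.Nat.Divisibility using (_∣_)
open import Data.Fin using (Fin; toℕ)
open import Data.Product using (Σ; _×_)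
open import Data.Sum using (_⊎_)
open import Relation.Nullary using (¬_)
open import Relation.Binary.PropositionalEquality using (_≡_)
open import Function.Definitions using (Injective)
open import Function.Bundles using (_⇔_)

record Graph : Set₁ where
  field
    V   : Set
    Adj : V → V → Set

CycNext : (k : ℕ) → Fin k → Fin k → Set
CycNext k i j = (toℕ j ≡ suc (toℕ i)) ⊎ ((toℕ i ≡ k ∸ 1) × (toℕ j ≡ 0))

CycAdj : (k : ℕ) → Fin k → Fin k → Set
CycAdj k i j = CycNext k i j ⊎ CycNext k j i

record InducedCycle (G : Graph) (k : ℕ) : Set where
  open Graph G
  field
    three≤k : 3 ≤ k
    vert    : Fin k → V
    inj     : Injective _≡_ _≡_ vert
    induced : ∀ i j → Adj (vert i) (vert j) ⇔ CycAdj k i j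

Ternary : Graph → Set
Ternary G = ∀ k → InducedCycle G k → ¬ (3 ∣ k)

data Vtx : Set where
  a b c : ℕ → Vtx

InG : ℕ → Vtx → Set
InG m (a i) = 1 ≤ i × i ≤ m
InG m (b i) = 1 ≤ i × i ≤ m
InG m (c i) = 2 ≤ i × i ≤ m

data Edge : ℕ → Vtx → Vtx → Set where
  e-a1b1 : Edge 1 (a 1) (b 1)
  e-old  : ∀ {m u v} → Edge m u v → Edge (suc m) u v
  e-aa   : ∀ {m} → 1 ≤ m → Edge (suc m) (a m) (a (suc m))
  e-bc   : ∀ {m} → 1 ≤ m → Edge (suc m) (b m) (c (suc m))
  e-ab   : ∀ {m} → 1 ≤ m → Edge (suc m) (a (suc m)) (b (suc m))
  e-bc'  : ∀ {m} → 1 ≤ m → Edge (suc m) (b (suc m)) (c (suc m))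
  e-ca   : ∀ {m} → 2 ≤ m → Edge (suc m) (c m) (a (suc m))

G : ℕ → Graph
G m = record
  { V   = Σ Vtx (InG m)
  ; Adj = λ u v → Edge m (Σ.proj₁ u) (Σ.proj₁ v) ⊎ Edge m (Σ.proj₁ v) (Σ.proj₁ u)
  }

{-# OPTIONS --safe #-}
module Submission where

-- Every induced cycle of G m has length 4 or 5.  All the G m live in one infinite
-- graph _∼_ on the vertices a n, b n, c n, and that graph has no triangles.  On a
-- longer induced cycle take a vertex of highest layer together with three cycle
-- vertices on either side of it.  No vertex of the cycle lies above the top, and in
-- the layers up to its own, b n has only the neighbours a n and c n, c (suc n) only
-- b (suc n) and b n, and a (suc n) only b (suc n), a n and c n, where a n and c n are
-- both adjacent to b n.  Following the cycle away from the top along these few edges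
-- always produces a chord between two of the seven vertices at cyclic distance 3 or 4.

open import Defs
open import Data.Nat
  using (ℕ; suc; _+_; _*_; _∸_; _≤_; _<_; _≤′_; ≤′-refl; ≤′-step; z≤n; s≤s; NonZero; >-nonZero; >-nonZero⁻¹)
open import Data.Nat.Properties
  using (1+n≰n; ≤-irrelevant; ≤⇒≤′; ≤-trans; m≤n+m; m≤m+n; n≤1+n; m≤n⇒m<n∨m≡n; m+[n∸m]≡n;
         +-suc; +-comm; +-assoc; +-cancelˡ-≡)
open import Data.Nat.DivMod
  using (_%_; _/_; _mod_; m≡m%n+[m/n]*n; m%n%n≡m%n; %-distribˡ-+; m<n⇒m%n≡m; n%n≡0; [m+n]%n≡m%n; m%n<n)
open import Data.Nat.Divisibility using (_∣_; n∣m*n; ∣m+n∣m⇒∣n; >⇒∤; _∣?_)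
open import Data.Fin using (Fin; toℕ)
open import Data.Fin.Properties using (toℕ-injective; toℕ<n; toℕ-fromℕ<)
open import Data.List using (allFin)
open import Data.List.Relation.Unary.All as All using ()
open import Data.List.Membership.Propositional.Properties using (∈-allFin)
open import Data.List.Extrema.Nat using (argmax; f[xs]≤f[argmax])
open import Data.Product using (Σ; _,_; proj₁; proj₂)
open import Data.Sum using (_⊎_; inj₁; inj₂; [_,_])
open import Data.Empty using (⊥; ⊥-elim)
open import Function using (_∘_; Equivalence)
open import Relation.Nullary using (¬_)
open import Relation.Nullary.Decidable using (from-no)
open import Relation.Binary.PropositionalEquality
  using (_≡_; _≢_; refl; sym; trans; cong; cong₂; subst; ≢-sym; module ≡-Reasoning)

private variable
  m n d : ℕ
  u v w x₀ x₁ x₂ x₃ x₄ x₅ x₆ : Vtx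

-- The edges of all G m at once, each listed in both orientations; an upper-case letter
-- marks the endpoint in the higher layer.  The relation also covers vertices such as
-- a 0 and c 1 that lie in no G m, which does no harm.
infix 4 _∼_

data _∼_ : Vtx → Vtx → Set where
  ab : a n ∼ b n
  ba : b n ∼ a n
  bc : b n ∼ c n
  cb : c n ∼ b n
  aA : a n ∼ a (suc n)
  Aa : a (suc n) ∼ a n
  bC : b n ∼ c (suc n)
  Cb : c (suc n) ∼ b n
  cA : c n ∼ a (suc n)
  Ac : a (suc n) ∼ c n

∼-sym : u ∼ v → v ∼ u
∼-sym ab = ba
∼-sym ba = ab
∼-sym bc = cb
∼-sym cb = bc
∼-sym aA = Aa
∼-sym Aa = aA
∼-sym bC = Cb
∼-sym Cb = bC
∼-sym cA = Ac
∼-sym Ac = cA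

layer : Vtx → ℕ
layer (a n) = n
layer (b n) = n
layer (c n) = n

∼-triangle-free : u ∼ v → v ∼ w → w ∼ u → ⊥
∼-triangle-free ab ba ()
∼-triangle-free ab bc ()
∼-triangle-free ab bC ()
∼-triangle-free ba ab ()
∼-triangle-free ba aA ()
∼-triangle-free ba Aa ()
∼-triangle-free ba Ac ()
∼-triangle-free bc cb ()
∼-triangle-free bc Cb ()
∼-triangle-free bc cA ()
∼-triangle-free cb ba ()
∼-triangle-free cb bc ()
∼-triangle-free cb bC ()
∼-triangle-free aA ab ()
∼-triangle-free aA aA ()
∼-triangle-free aA Aa ()
∼-triangle-free aA Ac ()
∼-triangle-free Aa ab ()
∼-triangle-free Aa aA ()
∼-triangle-free Aa Aa ()
∼-triangle-free Aa Ac ()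
∼-triangle-free bC cb ()
∼-triangle-free bC Cb ()
∼-triangle-free bC cA ()
∼-triangle-free Cb ba ()
∼-triangle-free Cb bc ()
∼-triangle-free Cb bC ()
∼-triangle-free cA ab ()
∼-triangle-free cA aA ()
∼-triangle-free cA Aa ()
∼-triangle-free cA Ac ()
∼-triangle-free Ac cb ()
∼-triangle-free Ac Cb ()
∼-triangle-free Ac cA ()

∼a⇒∼b : v ∼ a (suc n) → layer v ≤ suc n → v ≢ b (suc n) → v ∼ b n
∼a⇒∼b ba _ v≢b = ⊥-elim (v≢b refl)
∼a⇒∼b aA _ _ = ab
∼a⇒∼b Aa v≤ _ = ⊥-elim (1+n≰n v≤)
∼a⇒∼b cA _ _ = cb

-- Seven consecutive vertices of an induced cycle of length at least 6, centred at a
-- vertex x₃ of highest layer.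
record TopWindow (x₀ x₁ x₂ x₃ x₄ x₅ x₆ : Vtx) : Set where
  field
    ∼₀₁ : x₀ ∼ x₁
    ∼₁₂ : x₁ ∼ x₂
    ∼₂₃ : x₂ ∼ x₃
    ∼₃₄ : x₃ ∼ x₄
    ∼₄₅ : x₄ ∼ x₅
    ∼₅₆ : x₅ ∼ x₆
    ≢₀₂ : x₀ ≢ x₂
    ≢₁₃ : x₁ ≢ x₃
    ≢₂₄ : x₂ ≢ x₄
    ≢₃₅ : x₃ ≢ x₅
    ≢₄₆ : x₄ ≢ x₆
    ≁₀₄ : ¬ x₀ ∼ x₄
    ≁₂₆ : ¬ x₂ ∼ x₆
    ≁₁₅ : ¬ x₁ ∼ x₅
    ≁₁₄ : ¬ x₁ ∼ x₄
    ≁₂₅ : ¬ x₂ ∼ x₅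
    ≤₀ : layer x₀ ≤ layer x₃
    ≤₁ : layer x₁ ≤ layer x₃
    ≤₂ : layer x₂ ≤ layer x₃
    ≤₄ : layer x₄ ≤ layer x₃
    ≤₅ : layer x₅ ≤ layer x₃
    ≤₆ : layer x₆ ≤ layer x₃

open TopWindow

reverse : TopWindow x₀ x₁ x₂ x₃ x₄ x₅ x₆ → TopWindow x₆ x₅ x₄ x₃ x₂ x₁ x₀
reverse w = record
  { ∼₀₁ = ∼-sym (∼₅₆ w) ; ∼₁₂ = ∼-sym (∼₄₅ w) ; ∼₂₃ = ∼-sym (∼₃₄ w)
  ; ∼₃₄ = ∼-sym (∼₂₃ w) ; ∼₄₅ = ∼-sym (∼₁₂ w) ; ∼₅₆ = ∼-sym (∼₀₁ w)
  ; ≢₀₂ = ≢-sym (≢₄₆ w) ; ≢₁₃ = ≢-sym (≢₃₅ w) ; ≢₂₄ = ≢-sym (≢₂₄ w)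
  ; ≢₃₅ = ≢-sym (≢₁₃ w) ; ≢₄₆ = ≢-sym (≢₀₂ w)
  ; ≁₀₄ = ≁₂₆ w ∘ ∼-sym ; ≁₂₆ = ≁₀₄ w ∘ ∼-sym ; ≁₁₅ = ≁₁₅ w ∘ ∼-sym
  ; ≁₁₄ = ≁₂₅ w ∘ ∼-sym ; ≁₂₅ = ≁₁₄ w ∘ ∼-sym
  ; ≤₀ = ≤₆ w ; ≤₁ = ≤₅ w ; ≤₂ = ≤₄ w ; ≤₄ = ≤₂ w ; ≤₅ = ≤₁ w ; ≤₆ = ≤₀ w
  }

no-top-window-abc : ¬ TopWindow x₀ x₁ (a n) (b n) (c n) x₅ x₆
no-top-window-abc w with ∼₄₅ w
... | cb = ≢₃₅ w refl
... | cA = 1+n≰n (≤₅ w)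
... | Cb = ≁₁₅ w (∼a⇒∼b (∼₁₂ w) (≤₁ w) (≢₁₃ w))

no-top-window-bcb : ¬ TopWindow x₀ x₁ (b (suc n)) (c (suc n)) (b n) x₅ x₆
no-top-window-bcb w with ∼₁₂ w
... | ab = ≁₀₄ w (∼a⇒∼b (∼₀₁ w) (≤₀ w) (≢₀₂ w))
... | cb = ≢₁₃ w refl
... | Cb = 1+n≰n (≤₁ w)

no-top-window-ab : ¬ TopWindow x₀ x₁ x₂ (a n) (b n) x₅ x₆
no-top-window-ab w with ∼₄₅ w | ∼₅₆ w
... | ba | _  = ≢₃₅ w refl
... | bC | _  = 1+n≰n (≤₅ w)
... | bc | cb = ≢₄₆ w refl
... | bc | cA = 1+n≰n (≤₆ w)
... | bc | Cb = ≁₂₆ w (∼a⇒∼b (∼₂₃ w) (≤₂ w) (≢₂₄ w))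

no-top-window-aac : ¬ TopWindow x₀ x₁ (a n) (a (suc n)) (c n) x₅ x₆
no-top-window-aac w with ∼₄₅ w | ∼₁₂ w
... | cb | _  = ≁₂₅ w ab
... | cA | _  = ≢₃₅ w refl
... | Cb | ba = ≁₁₄ w bc
... | Cb | Aa = ≢₁₃ w refl
... | Cb | aA = ≁₁₅ w ab
... | Cb | cA = ≁₁₅ w cb

no-top-window : ¬ TopWindow x₀ x₁ x₂ x₃ x₄ x₅ x₆
no-top-window w with ∼₂₃ w | ∼₃₄ w
... | ab | bc = no-top-window-abc w
... | cb | ba = no-top-window-abc (reverse w)
... | ab | ba = ≢₂₄ w refl
... | cb | bc = ≢₂₄ w refl
... | Cb | _  = 1+n≰n (≤₂ w)
... | _  | bC = 1+n≰n (≤₄ w)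
... | bc | Cb = no-top-window-bcb w
... | bC | cb = no-top-window-bcb (reverse w)
... | bc | cb = ≢₂₄ w refl
... | bC | Cb = ≢₂₄ w refl
... | Ac | _  = 1+n≰n (≤₂ w)
... | _  | cA = 1+n≰n (≤₄ w)
... | aA | ab = no-top-window-ab w
... | cA | ab = no-top-window-ab w
... | ba | Aa = no-top-window-ab (reverse w)
... | ba | Ac = no-top-window-ab (reverse w)
... | aA | Ac = no-top-window-aac w
... | cA | Aa = no-top-window-aac (reverse w)
... | ba | ab = ≢₂₄ w refl
... | aA | Aa = ≢₂₄ w refl
... | cA | Ac = ≢₂₄ w refl
... | Aa | _  = 1+n≰n (≤₂ w)
... | _  | aA = 1+n≰n (≤₄ w)

Edge⇒∼ : Edge m u v → u ∼ v
Edge⇒∼ e-a1b1 = ab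
Edge⇒∼ (e-old e) = Edge⇒∼ e
Edge⇒∼ (e-aa _) = aA
Edge⇒∼ (e-bc _) = bC
Edge⇒∼ (e-ab _) = ab
Edge⇒∼ (e-bc' _) = bc
Edge⇒∼ (e-ca _) = cA

Edge-mono′ : ∀ {m m′} → m ≤′ m′ → Edge m u v → Edge m′ u v
Edge-mono′ ≤′-refl e = e
Edge-mono′ (≤′-step m≤′m′) e = e-old (Edge-mono′ m≤′m′ e)

Edge-mono : ∀ {m m′} → m ≤ m′ → Edge m u v → Edge m′ u v
Edge-mono = Edge-mono′ ∘ ≤⇒≤′

Edge-ab : 1 ≤ n → Edge n (a n) (b n)
Edge-ab {1} _ = e-a1b1
Edge-ab {suc (suc n)} _ = e-ab (s≤s z≤n)

∼⇒Edge : u ∼ v → InG m u → InG m v → Edge m u v ⊎ Edge m v u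
∼⇒Edge ab (1≤n , n≤m) _ = inj₁ (Edge-mono n≤m (Edge-ab 1≤n))
∼⇒Edge bc _ (s≤s 1≤n , n≤m) = inj₁ (Edge-mono n≤m (e-bc' 1≤n))
∼⇒Edge aA (1≤n , _) (_ , n<m) = inj₁ (Edge-mono n<m (e-aa 1≤n))
∼⇒Edge bC (1≤n , _) (_ , n<m) = inj₁ (Edge-mono n<m (e-bc 1≤n))
∼⇒Edge cA (2≤n , _) (_ , n<m) = inj₁ (Edge-mono n<m (e-ca 2≤n))
∼⇒Edge ba _ (1≤n , n≤m) = inj₂ (Edge-mono n≤m (Edge-ab 1≤n))
∼⇒Edge cb (s≤s 1≤n , n≤m) _ = inj₂ (Edge-mono n≤m (e-bc' 1≤n))
∼⇒Edge Aa (_ , n<m) (1≤n , _) = inj₂ (Edge-mono n<m (e-aa 1≤n))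
∼⇒Edge Cb (_ , n<m) (1≤n , _) = inj₂ (Edge-mono n<m (e-bc 1≤n))
∼⇒Edge Ac (_ , n<m) (2≤n , _) = inj₂ (Edge-mono n<m (e-ca 2≤n))

Adj⇒∼ : Edge m u v ⊎ Edge m v u → u ∼ v
Adj⇒∼ = [ Edge⇒∼ , ∼-sym ∘ Edge⇒∼ ]

InG-irrelevant : (p q : InG m v) → p ≡ q
InG-irrelevant {v = a _} (p , q) (p′ , q′) = cong₂ _,_ (≤-irrelevant p p′) (≤-irrelevant q q′)
InG-irrelevant {v = b _} (p , q) (p′ , q′) = cong₂ _,_ (≤-irrelevant p p′) (≤-irrelevant q q′)
InG-irrelevant {v = c _} (p , q) (p′ , q′) = cong₂ _,_ (≤-irrelevant p p′) (≤-irrelevant q q′)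

proj₁-injective : {x y : Σ Vtx (InG m)} → proj₁ x ≡ proj₁ y → x ≡ y
proj₁-injective {x = v , p} {.v , q} refl = cong (v ,_) (InG-irrelevant p q)

module _ {k : ℕ} .{{_ : NonZero k}} where

  [m+n]%k≡n%k⇒k∣m : (m + n) % k ≡ n % k → k ∣ m
  [m+n]%k≡n%k⇒k∣m {m} {n} eq = ∣m+n∣m⇒∣n (subst (k ∣_) shift (n∣m*n ((m + n) / k))) (n∣m*n (n / k))
    where
    open ≡-Reasoning
    shift : (m + n) / k * k ≡ n / k * k + m
    shift = +-cancelˡ-≡ (n % k) _ _ (begin
      n % k + (m + n) / k * k         ≡⟨ cong (_+ (m + n) / k * k) eq ⟨
      (m + n) % k + (m + n) / k * k   ≡⟨ m≡m%n+[m/n]*n (m + n) k ⟨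
      m + n                           ≡⟨ +-comm m n ⟩
      n + m                           ≡⟨ cong (_+ m) (m≡m%n+[m/n]*n n k) ⟩
      n % k + n / k * k + m           ≡⟨ +-assoc (n % k) _ m ⟩
      n % k + (n / k * k + m)         ∎)

  [1+n]%k≡[1+n%k]%k : ∀ n → suc n % k ≡ suc (n % k) % k
  [1+n]%k≡[1+n%k]%k n = begin
    (1 + n) % k               ≡⟨ %-distribˡ-+ 1 n k ⟩
    (1 % k + n % k) % k       ≡⟨ cong (λ r → (1 % k + r) % k) (m%n%n≡m%n n k) ⟨
    (1 % k + n % k % k) % k   ≡⟨ %-distribˡ-+ 1 (n % k) k ⟨
    (1 + n % k) % k           ∎
    where open ≡-Reasoning

  CycNext⇒≡% : {i j : Fin k} → CycNext k i j → toℕ j ≡ suc (toℕ i) % k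
  CycNext⇒≡% {i} {j} (inj₁ j≡1+i) = trans j≡1+i (sym (m<n⇒m%n≡m (subst (_< k) j≡1+i (toℕ<n j))))
  CycNext⇒≡% {i} {j} (inj₂ (i≡k∸1 , j≡0)) = begin
    toℕ j              ≡⟨ j≡0 ⟩
    0                  ≡⟨ n%n≡0 k ⟨
    k % k              ≡⟨ cong (_% k) 1+i≡k ⟨
    suc (toℕ i) % k    ∎
    where
    open ≡-Reasoning
    1+i≡k : suc (toℕ i) ≡ k
    1+i≡k = trans (cong suc i≡k∸1) (m+[n∸m]≡n (>-nonZero⁻¹ k))

  ≡%⇒CycNext : {i j : Fin k} → toℕ j ≡ suc (toℕ i) % k → CycNext k i j
  ≡%⇒CycNext {i} eq with m≤n⇒m<n∨m≡n (toℕ<n i)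
  ... | inj₁ 1+i<k = inj₁ (trans eq (m<n⇒m%n≡m 1+i<k))
  ... | inj₂ 1+i≡k = inj₂ (cong (_∸ 1) 1+i≡k , trans eq (trans (cong (_% k) 1+i≡k) (n%n≡0 k)))

  toℕ-mod : ∀ n → toℕ (n mod k) ≡ n % k
  toℕ-mod n = toℕ-fromℕ< (m%n<n n k)

  mod-CycNext : ∀ n → CycNext k (n mod k) (suc n mod k)
  mod-CycNext n = ≡%⇒CycNext (begin
    toℕ (suc n mod k)         ≡⟨ toℕ-mod (suc n) ⟩
    suc n % k                 ≡⟨ [1+n]%k≡[1+n%k]%k n ⟩
    suc (n % k) % k           ≡⟨ cong (λ r → suc r % k) (toℕ-mod n) ⟨
    suc (toℕ (n mod k)) % k   ∎)
    where open ≡-Reasoning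

  mod-CycNext⁻¹ : CycNext k (m mod k) (n mod k) → n % k ≡ suc m % k
  mod-CycNext⁻¹ {m} {n} m→n = begin
    n % k                     ≡⟨ toℕ-mod n ⟨
    toℕ (n mod k)             ≡⟨ CycNext⇒≡% m→n ⟩
    suc (toℕ (m mod k)) % k   ≡⟨ cong (λ r → suc r % k) (toℕ-mod m) ⟩
    suc (m % k) % k           ≡⟨ [1+n]%k≡[1+n%k]%k m ⟨
    suc m % k                 ∎
    where open ≡-Reasoning

  [d+n]mod≡[n]mod⇒k∣d : (d + n) mod k ≡ n mod k → k ∣ d
  [d+n]mod≡[n]mod⇒k∣d {d} {n} eq =
    [m+n]%k≡n%k⇒k∣m (trans (sym (toℕ-mod (d + n))) (trans (cong toℕ eq) (toℕ-mod n)))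

  mod-CycAdj : CycAdj k (n mod k) ((suc d + n) mod k) → k ∣ d ⊎ k ∣ suc (suc d)
  mod-CycAdj {n} {d} (inj₁ n→1+d+n) =
    inj₁ ([m+n]%k≡n%k⇒k∣m (trans (cong (_% k) (+-suc d n)) (mod-CycNext⁻¹ n→1+d+n)))
  mod-CycAdj (inj₂ 1+d+n→n) = inj₂ ([m+n]%k≡n%k⇒k∣m (sym (mod-CycNext⁻¹ 1+d+n→n)))

no-induced-triangle : ¬ InducedCycle (G m) 3
no-induced-triangle C = ∼-triangle-free (adj (inj₁ refl)) (adj (inj₁ refl)) (adj (inj₂ (refl , refl)))
  where
  open InducedCycle C
  adj : ∀ {i j} → CycNext 3 i j → proj₁ (vert i) ∼ proj₁ (vert j)
  adj = Adj⇒∼ ∘ Equivalence.from (induced _ _) ∘ inj₁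

module InducedCycleWalk {m k} (C : InducedCycle (G m) k) where
  open InducedCycle C

  instance
    k≢0 : NonZero k
    k≢0 = >-nonZero (≤-trans (s≤s z≤n) three≤k)

  walk : ℕ → Vtx
  walk n = proj₁ (vert (n mod k))

  walk-∼ : ∀ n → walk n ∼ walk (suc n)
  walk-∼ n = Adj⇒∼ (Equivalence.from (induced _ _) (inj₁ (mod-CycNext n)))

  walk-≢ : ∀ n → walk n ≢ walk (2 + n)
  walk-≢ n eq = >⇒∤ three≤k ([d+n]mod≡[n]mod⇒k∣d (sym (inj (proj₁-injective eq))))

  walk-≁ : ∀ n d .{{_ : NonZero d}} → 2 + d < k → ¬ walk n ∼ walk (suc d + n)
  walk-≁ n d d+2<k n∼1+d+n =
    [ >⇒∤ (≤-trans (m≤n+m (suc d) 2) d+2<k) , >⇒∤ d+2<k ]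
      (mod-CycAdj (Equivalence.to (induced _ _) (∼⇒Edge n∼1+d+n (proj₂ (vert _)) (proj₂ (vert _)))))

  layerAt : Fin k → ℕ
  layerAt i = layer (proj₁ (vert i))

  top : Fin k
  top = argmax layerAt (0 mod k) (allFin k)

  start : ℕ
  start = toℕ top + k ∸ 3

  3+start≡top : (3 + start) mod k ≡ top
  3+start≡top = toℕ-injective (begin
    toℕ ((3 + start) mod k)   ≡⟨ toℕ-mod (3 + start) ⟩
    (3 + start) % k           ≡⟨ cong (_% k) (m+[n∸m]≡n (≤-trans three≤k (m≤n+m k (toℕ top)))) ⟩
    (toℕ top + k) % k         ≡⟨ [m+n]%n≡m%n (toℕ top) k ⟩
    toℕ top % k               ≡⟨ m<n⇒m%n≡m (toℕ<n top) ⟩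
    toℕ top                   ∎)
    where open ≡-Reasoning

  walk-≤ : ∀ n → layer (walk n) ≤ layer (walk (3 + start))
  walk-≤ n = subst (λ i → layer (walk n) ≤ layerAt i) (sym 3+start≡top)
    (All.lookup (f[xs]≤f[argmax] {f = layerAt} (0 mod k) (allFin k)) (∈-allFin (n mod k)))

  window : 6 ≤ k → TopWindow (walk start) (walk (1 + start)) (walk (2 + start)) (walk (3 + start))
                             (walk (4 + start)) (walk (5 + start)) (walk (6 + start))
  window 6≤k = record
    { ∼₀₁ = walk-∼ start ; ∼₁₂ = walk-∼ (1 + start) ; ∼₂₃ = walk-∼ (2 + start)
    ; ∼₃₄ = walk-∼ (3 + start) ; ∼₄₅ = walk-∼ (4 + start) ; ∼₅₆ = walk-∼ (5 + start)
    ; ≢₀₂ = walk-≢ start ; ≢₁₃ = walk-≢ (1 + start) ; ≢₂₄ = walk-≢ (2 + start)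
    ; ≢₃₅ = walk-≢ (3 + start) ; ≢₄₆ = walk-≢ (4 + start)
    ; ≁₀₄ = walk-≁ start 3 6≤k ; ≁₂₆ = walk-≁ (2 + start) 3 6≤k ; ≁₁₅ = walk-≁ (1 + start) 3 6≤k
    ; ≁₁₄ = walk-≁ (1 + start) 2 5≤k ; ≁₂₅ = walk-≁ (2 + start) 2 5≤k
    ; ≤₀ = walk-≤ start ; ≤₁ = walk-≤ (1 + start) ; ≤₂ = walk-≤ (2 + start)
    ; ≤₄ = walk-≤ (4 + start) ; ≤₅ = walk-≤ (5 + start) ; ≤₆ = walk-≤ (6 + start)
    }
    where
    5≤k : 5 ≤ k
    5≤k = ≤-trans (n≤1+n 5) 6≤k

no-long-induced-cycle : ∀ {k} → 6 ≤ k → ¬ InducedCycle (G m) k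
no-long-induced-cycle 6≤k C = no-top-window (InducedCycleWalk.window C 6≤k)

induced-cycle-length : ∀ {k} → InducedCycle (G m) k → k ≡ 4 ⊎ k ≡ 5
induced-cycle-length C with InducedCycle.three≤k C
... | s≤s (s≤s (s≤s (z≤n {0}))) = ⊥-elim (no-induced-triangle C)
... | s≤s (s≤s (s≤s (z≤n {1}))) = inj₁ refl
... | s≤s (s≤s (s≤s (z≤n {2}))) = inj₂ refl
... | s≤s (s≤s (s≤s (z≤n {suc (suc (suc _))}))) = ⊥-elim (no-long-induced-cycle (m≤m+n 6 _) C)

lemma3p7 : ∀ m → 1 ≤ m → Ternary (G m)
lemma3p7 m _ k C 3∣k with induced-cycle-length C
... | inj₁ refl = from-no (3 ∣? 4) 3∣k
... | inj₂ refl = from-no (3 ∣? 5) 3∣k
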